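{- Let $w\in W(\widetilde{C}_2)$ be fully commutative, non-cancellable, and not of type I, and let $k\ge1$. If $\mathbf{r}_{k+1}=s_1s_3$, then $\mathbf{r}_k=s_2$; and if $\mathbf{r}_{k+1}=s_2$, then $\mathbf{r}_k=s_1s_3$.
   Context: $W(\widetilde{C}_2)$ is the Coxeter group with generators $s_1,s_2,s_3$, $m(s_1,s_2)=m(s_2,s_3)=4$, $m(s_1,s_3)=2$. $\mathcal{L},\mathcal{R}$ are left/right descent sets. Fully commutative: any two reduced expressions related by moves $st\mapsto ts$ with $m(s,t)=2$. A fully commutative $w$ is left weak star reducible by $s$ w.r.t. $t$ if $m(s,t)\ge3$, $s\in\mathcal{L}(w)$, $t\in\mathcal{L}(sw)$, and $tw$ is not fully commutative; right symmetrically; non-cancellable means neither left nor right weak star reducible by any $s$ w.r.t. any $t$. Type I: for fully commutative $w$, $w$ is of type I iff $w$ has a unique reduced expression whose heap is a chain, i.e. $w$ is a product $s_{a_1}s_{a_2}\cdots s_{a_r}$ with $|a_p-a_{p+1}|=1$ for all $p$ (zigzag words in $s_1,s_2,s_3$). Heap: for fully commutative $w$ with reduced expression $s_{x_1}\cdots s_{x_r}$, the heap is the poset on $\{1,\dots,r\}$ (entry $p$ labeled $s_{x_p}$) generated by $p$ above $q$ whenever $p<q$ and $s_{x_p},s_{x_q}$ do not commute (including equal). An entry is in row 1 if nothing is above it; otherwise its row is $1$ plus the maximum row of entries covering it. $\mathbf{r}_k$ is the $k$-th row, and $\mathbf{r}_k=s_{y_1}\cdots s_{y_m}$ means the entries of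 row $k$ are labeled exactly by $s_{y_1},\dots,s_{y_m}$, each once. -}

module Defs where

open import Data.Nat using (ℕ; zero; suc; _≤_; _<_; _⊔_; _≟_)
open import Data.List using (List; []; _∷_; _++_; length; map; filter; [_])
open import Data.List.Relation.Unary.Linked using (Linked)
open import Data.List.Relation.Binary.Permutation.Propositional using (_↭_)
open import Data.Product using (Σ; _×_; _,_; proj₁; proj₂; ∃₂)
open import Relation.Binary.PropositionalEquality using (_≡_; _≢_)
open import Relation.Binary.Construct.Closure.Equivalence using (EqClosure)
open import Relation.Nullary using (¬_; yes; no)

data Gen : Set where
  s₁ s₂ s₃ : Gen

m : Gen → Gen → ℕ
m s₁ s₁ = 1
m s₂ s₂ = 1
m s₃ s₃ = 1
m s₁ s₂ = 4
m s₂ s₁ = 4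
m s₂ s₃ = 4
m s₃ s₂ = 4
m s₁ s₃ = 2
m s₃ s₁ = 2

alt : Gen → Gen → ℕ → List Gen
alt s t zero = []
alt s t (suc n) = s ∷ alt t s n

data Step : List Gen → List Gen → Set where
  cancel : ∀ u v s → Step (u ++ s ∷ s ∷ v) (u ++ v)
  braid  : ∀ u v s t → s ≢ t →
           Step (u ++ alt s t (m s t) ++ v) (u ++ alt t s (m s t) ++ v)

_≈W_ : List Gen → List Gen → Set
_≈W_ = EqClosure Step

data CStep : List Gen → List Gen → Set where
  comm : ∀ u v s t → m s t ≡ 2 → CStep (u ++ s ∷ t ∷ v) (u ++ t ∷ s ∷ v)

_≈C_ : List Gen → List Gen → Set
_≈C_ = EqClosure CStep

Reduced : List Gen → Set
Reduced x = ∀ y → y ≈W x → length x ≤ length y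

HasLength : List Gen → ℕ → Set
HasLength x n = Σ (List Gen) (λ y → y ≈W x × length y ≡ n) × (∀ y → y ≈W x → n ≤ length y)

InL : Gen → List Gen → Set
InL s x = ∃₂ λ a b → HasLength (s ∷ x) a × HasLength x b × a < b

InR : Gen → List Gen → Set
InR s x = ∃₂ λ a b → HasLength (x ++ [ s ]) a × HasLength x b × a < b

FC : List Gen → Set
FC x = ∀ y z → y ≈W x → z ≈W x → Reduced y → Reduced z → y ≈C z

LeftWSR : Gen → Gen → List Gen → Set
LeftWSR s t x = 3 ≤ m s t × InL s x × InL t (s ∷ x) × ¬ FC (t ∷ x)

RightWSR : Gen → Gen → List Gen → Set
RightWSR s t x = 3 ≤ m s t × InR s x × InR t (x ++ [ s ]) × ¬ FC (x ++ [ t ])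

NonCancellable : List Gen → Set
NonCancellable x = (∀ s t → ¬ LeftWSR s t x) × (∀ s t → ¬ RightWSR s t x)

data Adj : Gen → Gen → Set where
  a12 : Adj s₁ s₂
  a21 : Adj s₂ s₁
  a23 : Adj s₂ s₃
  a32 : Adj s₃ s₂

-- type I: w has a reduced expression that is a zigzag word (heap is a chain)
TypeI : List Gen → Set
TypeI x = Σ (List Gen) λ y → y ≈W x × Reduced y × Linked Adj y

-- Entries are processed left to right; an earlier entry with
-- non-commuting (or equal) label lies above. Row = 1 + max row of entries above
-- (1 if none); this equals 1 + max over covering entries.
maxAbove : List (Gen × ℕ) → Gen → ℕ
maxAbove [] g = 0
maxAbove ((h , r) ∷ acc) g with m h g ≟ 2
... | yes _ = maxAbove acc g
... | no  _ = r ⊔ maxAbove acc g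

heapAux : List (Gen × ℕ) → List Gen → List (Gen × ℕ)
heapAux acc [] = acc
heapAux acc (g ∷ xs) = heapAux (acc ++ [ (g , suc (maxAbove acc g)) ]) xs

heapRows : List Gen → List (Gen × ℕ)
heapRows x = heapAux [] x

row : ℕ → List Gen → List Gen
row k x = map proj₁ (filter (λ e → proj₂ e ≟ k) (heapRows x))

-- A reduced word of W(C̃₂) splits into the rows of its heap, which alternate
-- between {s₂} and a nonempty subset of {s₁, s₃}. So row k+1 = s₁s₃ forces
-- row k = s₂, and row k+1 = s₂ forces row k to be s₁s₃ unless it is a lone
-- s₁ or s₃. In that case full commutativity (no factor s₂ s s₂ s or s s₂ s s₂
-- up to commutation) and non-cancellability (no left weak star reduction at the top)
-- force every odd row, going up and down from this one, to be a single
-- generator, alternating s₁ and s₃. Then the word itself is a zigzag, and w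
-- would be of type I.
module Submission where

open import Defs
open import Data.Empty using (⊥; ⊥-elim)
open import Data.List using (List; []; _∷_; _++_; _ʳ++_; _∷ʳ_; [_]; length; map; filter; reverse)
open import Data.List.Properties
  using (++-assoc; ++-identityʳ; ++-cancelˡ; length-++; map-++; filter-++; filter-accept; filter-reject; ʳ++-defn; ++-ʳ++; ∷ʳ-++)
open import Data.List.Relation.Unary.All using (All; []; _∷_; universal)
import Data.List.Relation.Unary.All as All
open import Data.List.Relation.Unary.All.Properties using (++⁺; map⁺)
open import Data.List.Relation.Unary.Any using (here; there)
open import Data.List.Relation.Unary.Linked using (Linked; []; [-]; _∷_)
import Data.List.Relation.Unary.Linked as Linked
open import Data.List.Relation.Binary.Permutation.Propositional using (_↭_; ↭-refl; ↭-swap)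
open import Data.List.Relation.Binary.Permutation.Propositional.Properties using (↭-length; ∈-resp-↭)
open import Data.Nat using (ℕ; zero; suc; _+_; _≤_; _<_; _≟_; _⊔_; z≤n; s≤s; ≤-pred; parity)
open import Data.Nat.Properties
  using (≤-refl; n≤1+n; ≤-antisym; m≤n⇒m≤1+n; <⇒≢; <⇒≱; m≤n+m; +-suc; <-cmp; ⊔-lub; ⊔-assoc; ⊔-idem; ⊔-identityʳ; m≤n⇒m⊔n≡n; +-identityʳ)
import Data.Parity.Base as ℙ
open import Data.Parity.Properties using (p≢p⁻¹; +-homo-+; suc-homo-⁻¹)
open import Data.Product using (_×_; _,_; proj₁; proj₂)
open import Data.Sum using (_⊎_; inj₁; inj₂; [_,_]′; map₂)
open import Function using (id; case_of_)
open import Relation.Binary using (Rel; tri<; tri≈; tri>)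
open import Relation.Binary.Construct.Closure.Equivalence using (gmap; gfold; return; symmetric)
open import Relation.Binary.Construct.Closure.ReflexiveTransitive using (ε; _◅◅_)
open import Relation.Binary.PropositionalEquality
  using (_≡_; _≢_; refl; sym; trans; cong; cong₂; subst; isEquivalence; module ≡-Reasoning)
open import Relation.Nullary using (¬_; yes; no)

data Commuting : Gen → Gen → Set where
  s₁s₃ : Commuting s₁ s₃
  s₃s₁ : Commuting s₃ s₁

commuting : ∀ {s t} → m s t ≡ 2 → Commuting s t
commuting {s₁} {s₃} _ = s₁s₃
commuting {s₃} {s₁} _ = s₃s₁
commuting {s₁} {s₁} ()
commuting {s₁} {s₂} ()
commuting {s₂} {s₁} ()
commuting {s₂} {s₂} ()
commuting {s₂} {s₃} ()
commuting {s₃} {s₂} ()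
commuting {s₃} {s₃} ()

≈W-sym : ∀ {a b} → a ≈W b → b ≈W a
≈W-sym = symmetric Step

++-≈W : ∀ P {a b} → a ≈W b → (P ++ a) ≈W (P ++ b)
++-≈W []      e = e
++-≈W (c ∷ P) e = gmap (c ∷_) cons-step (++-≈W P e)
  where
  cons-step : ∀ {a b} → Step a b → Step (c ∷ a) (c ∷ b)
  cons-step (cancel u v s)      = cancel (c ∷ u) v s
  cons-step (braid u v s t s≢t) = braid (c ∷ u) v s t s≢t

++-≈C : ∀ P {a b} → a ≈C b → (P ++ a) ≈C (P ++ b)
++-≈C []      e = e
++-≈C (c ∷ P) e = gmap (c ∷_) cons-step (++-≈C P e)
  where
  cons-step : ∀ {a b} → CStep a b → CStep (c ∷ a) (c ∷ b)
  cons-step (comm u v s t st) = comm (c ∷ u) v s t st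

CStep⇒Step : ∀ {a b} → CStep a b → Step a b
CStep⇒Step (comm u v s t st) with commuting st
... | s₁s₃ = braid u v s₁ s₃ λ ()
... | s₃s₁ = braid u v s₃ s₁ λ ()

≈C⇒≈W : ∀ {a b} → a ≈C b → a ≈W b
≈C⇒≈W = gmap id CStep⇒Step

length-++-middle : ∀ u {a b : List Gen} v → length a ≡ length b → length (u ++ a ++ v) ≡ length (u ++ b ++ v)
length-++-middle u {a} {b} v eq = begin
  length (u ++ a ++ v)              ≡⟨ length-++ u ⟩
  length u + length (a ++ v)        ≡⟨ cong (length u +_) (length-++ a) ⟩
  length u + (length a + length v)  ≡⟨ cong (λ n → length u + (n + length v)) eq ⟩
  length u + (length b + length v)  ≡⟨ cong (length u +_) (length-++ b) ⟨
  length u + length (b ++ v)        ≡⟨ length-++ u ⟨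
  length (u ++ b ++ v)              ∎
  where open ≡-Reasoning

≈C-length : ∀ {a b} → a ≈C b → length a ≡ length b
≈C-length = gfold isEquivalence length λ { (comm u v s t _) → length-++-middle u {s ∷ t ∷ []} {t ∷ s ∷ []} v refl }

length-alt : ∀ s t n → length (alt s t n) ≡ n
length-alt s t zero    = refl
length-alt s t (suc n) = cong suc (length-alt t s n)

≈W-parity : ∀ {a b} → a ≈W b → parity (length a) ≡ parity (length b)
≈W-parity = gfold isEquivalence (λ w → parity (length w)) step-parity
  where
  step-parity : ∀ {a b} → Step a b → parity (length a) ≡ parity (length b)
  step-parity (cancel u v s) = begin
    parity (length (u ++ s ∷ s ∷ v))           ≡⟨ cong parity (length-++ u) ⟩
    parity (length u + suc (suc (length v)))  ≡⟨ +-homo-+ (length u) _ ⟩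
    parity (length u) ℙ.+ parity (length v)    ≡⟨ +-homo-+ (length u) _ ⟨
    parity (length u + length v)               ≡⟨ cong parity (length-++ u) ⟨
    parity (length (u ++ v))                   ∎
    where open ≡-Reasoning
  step-parity (braid u v s t _) =
    cong parity (length-++-middle u {alt s t (m s t)} {alt t s (m s t)} v (trans (length-alt s t (m s t)) (sym (length-alt t s (m s t)))))

parity-suc-≢ : ∀ n → parity n ≢ parity (suc n)
parity-suc-≢ n eq = p≢p⁻¹ (parity (suc n)) (sym (trans (suc-homo-⁻¹ n) eq))

-- Commutations only swap s₁ and s₃, so erasing either one is an invariant.

erase₁ erase₃ : List Gen → List Gen
erase₁ []       = []
erase₁ (s₁ ∷ w) = erase₁ w
erase₁ (s₂ ∷ w) = s₂ ∷ erase₁ w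
erase₁ (s₃ ∷ w) = s₃ ∷ erase₁ w
erase₃ []       = []
erase₃ (s₁ ∷ w) = s₁ ∷ erase₃ w
erase₃ (s₂ ∷ w) = s₂ ∷ erase₃ w
erase₃ (s₃ ∷ w) = erase₃ w

erase₁-++ : ∀ a b → erase₁ (a ++ b) ≡ erase₁ a ++ erase₁ b
erase₁-++ []       b = refl
erase₁-++ (s₁ ∷ a) b = erase₁-++ a b
erase₁-++ (s₂ ∷ a) b = cong (s₂ ∷_) (erase₁-++ a b)
erase₁-++ (s₃ ∷ a) b = cong (s₃ ∷_) (erase₁-++ a b)

erase₃-++ : ∀ a b → erase₃ (a ++ b) ≡ erase₃ a ++ erase₃ b
erase₃-++ []       b = refl
erase₃-++ (s₁ ∷ a) b = cong (s₁ ∷_) (erase₃-++ a b)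
erase₃-++ (s₂ ∷ a) b = cong (s₂ ∷_) (erase₃-++ a b)
erase₃-++ (s₃ ∷ a) b = erase₃-++ a b

≈C-erase₁ : ∀ {a b} → a ≈C b → erase₁ a ≡ erase₁ b
≈C-erase₁ = gfold isEquivalence erase₁ step
  where
  step : ∀ {a b} → CStep a b → erase₁ a ≡ erase₁ b
  step (comm u v s t st) with commuting st
  ... | s₁s₃ = trans (erase₁-++ u _) (sym (erase₁-++ u _))
  ... | s₃s₁ = trans (erase₁-++ u _) (sym (erase₁-++ u _))

≈C-erase₃ : ∀ {a b} → a ≈C b → erase₃ a ≡ erase₃ b
≈C-erase₃ = gfold isEquivalence erase₃ step
  where
  step : ∀ {a b} → CStep a b → erase₃ a ≡ erase₃ b
  step (comm u v s t st) with commuting st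
  ... | s₁s₃ = trans (erase₃-++ u _) (sym (erase₃-++ u _))
  ... | s₃s₁ = trans (erase₃-++ u _) (sym (erase₃-++ u _))

Adj-sym : ∀ {a b} → Adj a b → Adj b a
Adj-sym a12 = a21
Adj-sym a21 = a12
Adj-sym a23 = a32
Adj-sym a32 = a23

≈C-erase₁-cancelˡ : ∀ P {u v} → (P ++ u) ≈C (P ++ v) → erase₁ u ≡ erase₁ v
≈C-erase₁-cancelˡ P c =
  ++-cancelˡ (erase₁ P) _ _ (trans (sym (erase₁-++ P _)) (trans (≈C-erase₁ c) (erase₁-++ P _)))

≈C-erase₃-cancelˡ : ∀ P {u v} → (P ++ u) ≈C (P ++ v) → erase₃ u ≡ erase₃ v
≈C-erase₃-cancelˡ P c =
  ++-cancelˡ (erase₃ P) _ _ (trans (sym (erase₃-++ P _)) (trans (≈C-erase₃ c) (erase₃-++ P _)))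

≉C-Adj-heads : ∀ P {a b u v} → Adj a b → ¬ (P ++ a ∷ u) ≈C (P ++ b ∷ v)
≉C-Adj-heads P a12 c = case ≈C-erase₃-cancelˡ P c of λ ()
≉C-Adj-heads P a21 c = case ≈C-erase₃-cancelˡ P c of λ ()
≉C-Adj-heads P a23 c = case ≈C-erase₁-cancelˡ P c of λ ()
≉C-Adj-heads P a32 c = case ≈C-erase₁-cancelˡ P c of λ ()

reduced-≈ : ∀ {x y} → Reduced x → y ≈W x → length y ≡ length x → Reduced y
reduced-≈ red y≈x eq z z≈y = subst (_≤ length z) (sym eq) (red z (z≈y ◅◅ y≈x))

reduced-tail : ∀ {c x} → Reduced (c ∷ x) → Reduced x
reduced-tail {c} red y y≈x = ≤-pred (red (c ∷ y) (++-≈W [ c ] y≈x))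

reduced-shortest : ∀ {x y} → Reduced x → x ≈W y → ¬ length y < length x
reduced-shortest red x≈y lt = <⇒≱ lt (red _ (≈W-sym x≈y))

braid₄ : ∀ P Q {a b} → Adj a b → Step (P ++ a ∷ b ∷ a ∷ b ∷ Q) (P ++ b ∷ a ∷ b ∷ a ∷ Q)
braid₄ P Q a12 = braid P Q s₁ s₂ λ ()
braid₄ P Q a21 = braid P Q s₂ s₁ λ ()
braid₄ P Q a23 = braid P Q s₂ s₃ λ ()
braid₄ P Q a32 = braid P Q s₃ s₂ λ ()

-- Both sides of the braid relation are reduced expressions of the same element,
-- but they are not commutation equivalent.
fc-braid-free : ∀ {x} P Q {a b} → Adj a b → Reduced x → FC x → ¬ x ≈C (P ++ a ∷ b ∷ a ∷ b ∷ Q)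
fc-braid-free {x} P Q {a} {b} adj red fc x≈C =
  ≉C-Adj-heads P adj
    (fc abab baba abab≈x baba≈x (reduced-≈ red abab≈x abab-length) (reduced-≈ red baba≈x baba-length))
  where
  abab = P ++ a ∷ b ∷ a ∷ b ∷ Q
  baba = P ++ b ∷ a ∷ b ∷ a ∷ Q
  abab≈x : abab ≈W x
  abab≈x = ≈W-sym (≈C⇒≈W x≈C)
  baba≈x : baba ≈W x
  baba≈x = ≈W-sym (return (braid₄ P Q adj)) ◅◅ abab≈x
  abab-length : length abab ≡ length x
  abab-length = sym (≈C-length x≈C)
  baba-length : length baba ≡ length x
  baba-length = trans (length-++-middle P {b ∷ a ∷ b ∷ a ∷ []} {a ∷ b ∷ a ∷ b ∷ []} Q refl) abab-length

reduced⇒hasLength : ∀ {v w} → Reduced w → v ≈W w → HasLength v (length w)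
reduced⇒hasLength {w = w} red v≈w = (w , ≈W-sym v≈w , refl) , λ y y≈v → red y (y≈v ◅◅ v≈w)

InL-head : ∀ {s w x} → Reduced (s ∷ w) → x ≈W (s ∷ w) → InL s x
InL-head {s} {w} red x≈sw = length w , length (s ∷ w) ,
  reduced⇒hasLength (reduced-tail red) (++-≈W [ s ] x≈sw ◅◅ return (cancel [] w s)) ,
  reduced⇒hasLength red x≈sw , ≤-refl

-- A shorter expression y of t s t w would give a reduced expression t y of
-- s t w (parity rules out equal length), contradicting full commutativity.
reduced-prepend : ∀ {s t w} → Adj s t → Reduced (s ∷ t ∷ w) → FC (s ∷ t ∷ w) → Reduced (t ∷ s ∷ t ∷ w)
reduced-prepend {s} {t} {w} adj red fc y y≈ = case <-cmp (length y) (length (s ∷ t ∷ w)) of λ where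
    (tri> _ _ longer)  → longer
    (tri≈ _ same _)    → ⊥-elim (parity-suc-≢ (length (s ∷ t ∷ w)) (trans (cong parity (sym same)) (≈W-parity y≈)))
    (tri< shorter _ _) → ⊥-elim (≉C-Adj-heads [] (Adj-sym adj)
      (fc (t ∷ y) (s ∷ t ∷ w) ty≈ ε (reduced-≈ red ty≈ (≤-antisym shorter (red (t ∷ y) ty≈))) red))
  where
  ty≈ : (t ∷ y) ≈W (s ∷ t ∷ w)
  ty≈ = ++-≈W [ t ] y≈ ◅◅ return (cancel [] (s ∷ t ∷ w) t)

Adj⇒3≤m : ∀ {s t} → Adj s t → 3 ≤ m s t
Adj⇒3≤m a12 = s≤s (s≤s (s≤s z≤n))
Adj⇒3≤m a21 = s≤s (s≤s (s≤s z≤n))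
Adj⇒3≤m a23 = s≤s (s≤s (s≤s z≤n))
Adj⇒3≤m a32 = s≤s (s≤s (s≤s z≤n))

leftWSR : ∀ {s t w w′} → Adj s t → Reduced (s ∷ t ∷ w) → FC (s ∷ t ∷ w) → w ≈C (s ∷ w′) →
          LeftWSR s t (s ∷ t ∷ w)
leftWSR {s} {t} {w} {w′} adj red fc w≈sw′ =
  Adj⇒3≤m adj , InL-head red ε , InL-head (reduced-tail red) (return (cancel [] (t ∷ w) s)) , ¬FC
  where
  ¬FC : ¬ FC (t ∷ s ∷ t ∷ w)
  ¬FC fc′ = fc-braid-free [] w′ (Adj-sym adj) (reduced-prepend adj red fc) fc′ (++-≈C (t ∷ s ∷ t ∷ []) w≈sw′)

-- r₁₃ and r₃₁ are the same row {s₁, s₃}; both orders are kept so that a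
-- reduced word is recovered exactly from its rows.
data Row : Set where
  r₂ r₁ r₃ r₁₃ r₃₁ : Row

labels : Row → List Gen
labels r₂  = s₂ ∷ []
labels r₁  = s₁ ∷ []
labels r₃  = s₃ ∷ []
labels r₁₃ = s₁ ∷ s₃ ∷ []
labels r₃₁ = s₃ ∷ s₁ ∷ []

data OddRow : Row → Set where
  odd₁  : OddRow r₁
  odd₃  : OddRow r₃
  odd₁₃ : OddRow r₁₃
  odd₃₁ : OddRow r₃₁

data Stacked : Row → Row → Set where
  r₂-over : ∀ {R} → OddRow R → Stacked r₂ R
  over-r₂ : ∀ {R} → OddRow R → Stacked R r₂

flatten : List Row → List Gen
flatten []       = []
flatten (R ∷ Rs) = labels R ++ flatten Rs

flatten-++ : ∀ Rs Rs′ → flatten (Rs ++ Rs′) ≡ flatten Rs ++ flatten Rs′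
flatten-++ []       Rs′ = refl
flatten-++ (R ∷ Rs) Rs′ = trans (cong (labels R ++_) (flatten-++ Rs Rs′)) (sym (++-assoc (labels R) (flatten Rs) _))

toRows : List Gen → List Row
toRows []            = []
toRows (s₂ ∷ w)       = r₂ ∷ toRows w
toRows (s₁ ∷ s₃ ∷ w)  = r₁₃ ∷ toRows w
toRows (s₁ ∷ w)       = r₁ ∷ toRows w
toRows (s₃ ∷ s₁ ∷ w)  = r₃₁ ∷ toRows w
toRows (s₃ ∷ w)       = r₃ ∷ toRows w

flatten-toRows : ∀ w → flatten (toRows w) ≡ w
flatten-toRows []            = refl
flatten-toRows (s₂ ∷ w)      = cong (s₂ ∷_) (flatten-toRows w)
flatten-toRows (s₁ ∷ s₃ ∷ w) = cong (λ v → s₁ ∷ s₃ ∷ v) (flatten-toRows w)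
flatten-toRows (s₁ ∷ [])     = refl
flatten-toRows (s₁ ∷ s₁ ∷ w) = cong (s₁ ∷_) (flatten-toRows (s₁ ∷ w))
flatten-toRows (s₁ ∷ s₂ ∷ w) = cong (s₁ ∷_) (flatten-toRows (s₂ ∷ w))
flatten-toRows (s₃ ∷ s₁ ∷ w) = cong (λ v → s₃ ∷ s₁ ∷ v) (flatten-toRows w)
flatten-toRows (s₃ ∷ [])     = refl
flatten-toRows (s₃ ∷ s₂ ∷ w) = cong (s₃ ∷_) (flatten-toRows (s₂ ∷ w))
flatten-toRows (s₃ ∷ s₃ ∷ w) = cong (s₃ ∷_) (flatten-toRows (s₃ ∷ w))

data StartsOdd : List Row → Set where
  starts-odd : ∀ {R Rs} → OddRow R → StartsOdd (R ∷ Rs)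

toRows-s₁-starts-odd : ∀ w → StartsOdd (toRows (s₁ ∷ w))
toRows-s₁-starts-odd []       = starts-odd odd₁
toRows-s₁-starts-odd (s₁ ∷ w) = starts-odd odd₁
toRows-s₁-starts-odd (s₂ ∷ w) = starts-odd odd₁
toRows-s₁-starts-odd (s₃ ∷ w) = starts-odd odd₁₃

toRows-s₃-starts-odd : ∀ w → StartsOdd (toRows (s₃ ∷ w))
toRows-s₃-starts-odd []       = starts-odd odd₃
toRows-s₃-starts-odd (s₁ ∷ w) = starts-odd odd₃₁
toRows-s₃-starts-odd (s₂ ∷ w) = starts-odd odd₃
toRows-s₃-starts-odd (s₃ ∷ w) = starts-odd odd₃

r₂∷-stacked : ∀ {Rs} → StartsOdd Rs → Linked Stacked Rs → Linked Stacked (r₂ ∷ Rs)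
r₂∷-stacked (starts-odd o) ch = r₂-over o ∷ ch

toRows-stacked : ∀ w → Reduced w → Linked Stacked (toRows w)
toRows-stacked []                 red = []
toRows-stacked (s₂ ∷ [])          red = [-]
toRows-stacked (s₂ ∷ s₂ ∷ w)      red = ⊥-elim (reduced-shortest red (return (cancel [] w s₂)) (s≤s (n≤1+n _)))
toRows-stacked (s₂ ∷ s₁ ∷ w)      red = r₂∷-stacked (toRows-s₁-starts-odd w) (toRows-stacked (s₁ ∷ w) (reduced-tail red))
toRows-stacked (s₂ ∷ s₃ ∷ w)      red = r₂∷-stacked (toRows-s₃-starts-odd w) (toRows-stacked (s₃ ∷ w) (reduced-tail red))
toRows-stacked (s₁ ∷ [])          red = [-]
toRows-stacked (s₁ ∷ s₁ ∷ w)      red = ⊥-elim (reduced-shortest red (return (cancel [] w s₁)) (s≤s (n≤1+n _)))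
toRows-stacked (s₁ ∷ s₂ ∷ w)      red = over-r₂ odd₁ ∷ toRows-stacked (s₂ ∷ w) (reduced-tail red)
toRows-stacked (s₁ ∷ s₃ ∷ [])     red = [-]
toRows-stacked (s₁ ∷ s₃ ∷ s₁ ∷ w) red =
  ⊥-elim (reduced-shortest red (return (CStep⇒Step (comm [ s₁ ] w s₃ s₁ refl)) ◅◅ return (cancel [] (s₃ ∷ w) s₁)) (s≤s (n≤1+n _)))
toRows-stacked (s₁ ∷ s₃ ∷ s₃ ∷ w) red = ⊥-elim (reduced-shortest red (return (cancel [ s₁ ] w s₃)) (s≤s (s≤s (n≤1+n _))))
toRows-stacked (s₁ ∷ s₃ ∷ s₂ ∷ w) red = over-r₂ odd₁₃ ∷ toRows-stacked (s₂ ∷ w) (reduced-tail (reduced-tail red))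
toRows-stacked (s₃ ∷ [])          red = [-]
toRows-stacked (s₃ ∷ s₃ ∷ w)      red = ⊥-elim (reduced-shortest red (return (cancel [] w s₃)) (s≤s (n≤1+n _)))
toRows-stacked (s₃ ∷ s₂ ∷ w)      red = over-r₂ odd₃ ∷ toRows-stacked (s₂ ∷ w) (reduced-tail red)
toRows-stacked (s₃ ∷ s₁ ∷ [])     red = [-]
toRows-stacked (s₃ ∷ s₁ ∷ s₃ ∷ w) red =
  ⊥-elim (reduced-shortest red (return (CStep⇒Step (comm [ s₃ ] w s₁ s₃ refl)) ◅◅ return (cancel [] (s₁ ∷ w) s₃)) (s≤s (n≤1+n _)))
toRows-stacked (s₃ ∷ s₁ ∷ s₁ ∷ w) red = ⊥-elim (reduced-shortest red (return (cancel [ s₃ ] w s₁)) (s≤s (s≤s (n≤1+n _))))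
toRows-stacked (s₃ ∷ s₁ ∷ s₂ ∷ w) red = over-r₂ odd₃₁ ∷ toRows-stacked (s₂ ∷ w) (reduced-tail (reduced-tail red))

-- The heap of a stacked word

rowOf : ℕ → List (Gen × ℕ) → List Gen
rowOf k es = map proj₁ (filter (λ e → proj₂ e ≟ k) es)

atRow : ℕ → List Gen → List (Gen × ℕ)
atRow n gs = map (λ g → g , n) gs

stack : ℕ → List Row → List (Gen × ℕ)
stack j []       = []
stack j (R ∷ Rs) = atRow (suc j) (labels R) ++ stack (suc j) Rs

-- rowLabels Rs i is the heap row i + 1; it is empty past the last row.
rowLabels : List Row → ℕ → List Gen
rowLabels []       i       = []
rowLabels (R ∷ Rs) zero    = labels R
rowLabels (R ∷ Rs) (suc i) = rowLabels Rs i

AtMost : ℕ → List (Gen × ℕ) → Set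
AtMost j es = All (λ e → proj₂ e ≤ j) es

-- The rows of acc end at j, and every label of R lies directly below row j.
Ready : ℕ → List (Gen × ℕ) → Row → Set
Ready j acc R = AtMost j acc × All (λ g → maxAbove acc g ≡ j) (labels R)

maxAbove-++ : ∀ es es′ g → maxAbove (es ++ es′) g ≡ maxAbove es g ⊔ maxAbove es′ g
maxAbove-++ []             es′ g = refl
maxAbove-++ ((h , r) ∷ es) es′ g with m h g ≟ 2
... | yes _ = maxAbove-++ es es′ g
... | no  _ = trans (cong (r ⊔_) (maxAbove-++ es es′ g)) (sym (⊔-assoc r _ _))

maxAbove-≤ : ∀ {j es} g → AtMost j es → maxAbove es g ≤ j
maxAbove-≤ {es = []}            g []       = z≤n
maxAbove-≤ {es = (h , r) ∷ es} g (p ∷ ps) with m h g ≟ 2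
... | yes _ = maxAbove-≤ g ps
... | no  _ = ⊔-lub p (maxAbove-≤ g ps)

maxAbove-++-top : ∀ {j acc} es g → AtMost j acc → maxAbove es g ≡ suc j → maxAbove (acc ++ es) g ≡ suc j
maxAbove-++-top {j} {acc} es g acc≤j es-top = begin
  maxAbove (acc ++ es) g          ≡⟨ maxAbove-++ acc es g ⟩
  maxAbove acc g ⊔ maxAbove es g  ≡⟨ cong (maxAbove acc g ⊔_) es-top ⟩
  maxAbove acc g ⊔ suc j          ≡⟨ m≤n⇒m⊔n≡n (m≤n⇒m≤1+n (maxAbove-≤ g acc≤j)) ⟩
  suc j                           ∎
  where open ≡-Reasoning

heapAux-++ : ∀ acc xs ys → heapAux acc (xs ++ ys) ≡ heapAux (heapAux acc xs) ys
heapAux-++ acc []       ys = refl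
heapAux-++ acc (g ∷ xs) ys = heapAux-++ _ xs ys

heapAux-row : ∀ j acc R → Ready j acc R → heapAux acc (labels R) ≡ acc ++ atRow (suc j) (labels R)
heapAux-row j acc r₂  (_ , p ∷ []) = cong (λ n → acc ++ [ s₂ , suc n ]) p
heapAux-row j acc r₁  (_ , p ∷ []) = cong (λ n → acc ++ [ s₁ , suc n ]) p
heapAux-row j acc r₃  (_ , p ∷ []) = cong (λ n → acc ++ [ s₃ , suc n ]) p
heapAux-row j acc r₁₃ (_ , p₁ ∷ p₃ ∷ [])
  rewrite p₁ | maxAbove-++ acc [ s₁ , suc j ] s₃ | ⊔-identityʳ (maxAbove acc s₃) | p₃ = ++-assoc acc _ _
heapAux-row j acc r₃₁ (_ , p₃ ∷ p₁ ∷ [])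
  rewrite p₃ | maxAbove-++ acc [ s₃ , suc j ] s₁ | ⊔-identityʳ (maxAbove acc s₁) | p₁ = ++-assoc acc _ _

atRow-AtMost : ∀ n gs → AtMost n (atRow n gs)
atRow-AtMost n gs = map⁺ (universal (λ _ → ≤-refl) gs)

-- Consecutive rows never commute, so the next row lies directly below R.
Ready-next : ∀ {j acc R R′} → Ready j acc R → Stacked R R′ → Ready (suc j) (acc ++ atRow (suc j) (labels R)) R′
Ready-next {j} {acc} {R} (acc≤j , _) st = ++⁺ (All.map m≤n⇒m≤1+n acc≤j) (atRow-AtMost (suc j) (labels R)) , below st
  where
  top : ∀ g → maxAbove (atRow (suc j) (labels R)) g ≡ suc j → maxAbove (acc ++ atRow (suc j) (labels R)) g ≡ suc j
  top g = maxAbove-++-top (atRow (suc j) (labels R)) g acc≤j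
  below : ∀ {R′} → Stacked R R′ → All (λ g → maxAbove (acc ++ atRow (suc j) (labels R)) g ≡ suc j) (labels R′)
  below (r₂-over odd₁)  = top s₁ refl ∷ []
  below (r₂-over odd₃)  = top s₃ refl ∷ []
  below (r₂-over odd₁₃) = top s₁ refl ∷ top s₃ refl ∷ []
  below (r₂-over odd₃₁) = top s₃ refl ∷ top s₁ refl ∷ []
  below (over-r₂ odd₁)  = top s₂ refl ∷ []
  below (over-r₂ odd₃)  = top s₂ refl ∷ []
  below (over-r₂ odd₁₃) = top s₂ (⊔-idem (suc j)) ∷ []
  below (over-r₂ odd₃₁) = top s₂ (⊔-idem (suc j)) ∷ []

heapAux-stack : ∀ j acc R Rs → Ready j acc R → Linked Stacked (R ∷ Rs) →
                heapAux acc (flatten (R ∷ Rs)) ≡ acc ++ stack j (R ∷ Rs)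
heapAux-stack j acc R [] ready _ = begin
  heapAux acc (labels R ++ [])            ≡⟨ cong (heapAux acc) (++-identityʳ (labels R)) ⟩
  heapAux acc (labels R)                  ≡⟨ heapAux-row j acc R ready ⟩
  acc ++ atRow (suc j) (labels R)         ≡⟨ cong (acc ++_) (++-identityʳ _) ⟨
  acc ++ atRow (suc j) (labels R) ++ []   ∎
  where open ≡-Reasoning
heapAux-stack j acc R (R′ ∷ Rs) ready (st ∷ ch) = begin
  heapAux acc (labels R ++ flatten (R′ ∷ Rs))                        ≡⟨ heapAux-++ acc (labels R) _ ⟩
  heapAux (heapAux acc (labels R)) (flatten (R′ ∷ Rs))               ≡⟨ cong (λ a → heapAux a (flatten (R′ ∷ Rs))) (heapAux-row j acc R ready) ⟩
  heapAux (acc ++ atRow (suc j) (labels R)) (flatten (R′ ∷ Rs))      ≡⟨ heapAux-stack (suc j) _ R′ Rs (Ready-next ready st) ch ⟩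
  (acc ++ atRow (suc j) (labels R)) ++ stack (suc j) (R′ ∷ Rs)       ≡⟨ ++-assoc acc _ _ ⟩
  acc ++ stack j (R ∷ R′ ∷ Rs)                                        ∎
  where open ≡-Reasoning

Ready-top : ∀ R → Ready 0 [] R
Ready-top r₂  = [] , refl ∷ []
Ready-top r₁  = [] , refl ∷ []
Ready-top r₃  = [] , refl ∷ []
Ready-top r₁₃ = [] , refl ∷ refl ∷ []
Ready-top r₃₁ = [] , refl ∷ refl ∷ []

heapRows-flatten : ∀ {Rs} → Linked Stacked Rs → heapRows (flatten Rs) ≡ stack 0 Rs
heapRows-flatten {[]}     _  = refl
heapRows-flatten {R ∷ Rs} ch = heapAux-stack 0 [] R Rs (Ready-top R) ch

rowOf-++ : ∀ k es es′ → rowOf k (es ++ es′) ≡ rowOf k es ++ rowOf k es′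
rowOf-++ k es es′ = trans (cong (map proj₁) (filter-++ (λ e → proj₂ e ≟ k) es es′)) (map-++ proj₁ (filter (λ e → proj₂ e ≟ k) es) _)

rowOf-atRow : ∀ n gs → rowOf n (atRow n gs) ≡ gs
rowOf-atRow n []       = refl
rowOf-atRow n (g ∷ gs) rewrite filter-accept (λ e → proj₂ e ≟ n) {x = g , n} {xs = atRow n gs} refl =
  cong (g ∷_) (rowOf-atRow n gs)

rowOf-atRow-≢ : ∀ {n k} gs → n ≢ k → rowOf k (atRow n gs) ≡ []
rowOf-atRow-≢ {n} {k} []       n≢k = refl
rowOf-atRow-≢ {n} {k} (g ∷ gs) n≢k rewrite filter-reject (λ e → proj₂ e ≟ k) {x = g , n} {xs = atRow n gs} n≢k =
  rowOf-atRow-≢ gs n≢k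

rowOf-stack-above : ∀ {k j} Rs → k ≤ j → rowOf k (stack j Rs) ≡ []
rowOf-stack-above             []       k≤j = refl
rowOf-stack-above {k} {j} (R ∷ Rs) k≤j = begin
  rowOf k (atRow (suc j) (labels R) ++ stack (suc j) Rs)          ≡⟨ rowOf-++ k (atRow (suc j) (labels R)) _ ⟩
  rowOf k (atRow (suc j) (labels R)) ++ rowOf k (stack (suc j) Rs) ≡⟨ cong (_++ rowOf k (stack (suc j) Rs)) (rowOf-atRow-≢ (labels R) (λ 1+j≡k → <⇒≢ (s≤s k≤j) (sym 1+j≡k))) ⟩
  rowOf k (stack (suc j) Rs)                                        ≡⟨ rowOf-stack-above Rs (m≤n⇒m≤1+n k≤j) ⟩
  []                                                                ∎
  where open ≡-Reasoning

rowOf-stack : ∀ j Rs i → rowOf (suc (i + j)) (stack j Rs) ≡ rowLabels Rs i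
rowOf-stack j []       i       = refl
rowOf-stack j (R ∷ Rs) zero    = begin
  rowOf (suc j) (atRow (suc j) (labels R) ++ stack (suc j) Rs)               ≡⟨ rowOf-++ (suc j) (atRow (suc j) (labels R)) _ ⟩
  rowOf (suc j) (atRow (suc j) (labels R)) ++ rowOf (suc j) (stack (suc j) Rs) ≡⟨ cong₂ _++_ (rowOf-atRow (suc j) (labels R)) (rowOf-stack-above Rs ≤-refl) ⟩
  labels R ++ []                                                              ≡⟨ ++-identityʳ (labels R) ⟩
  labels R                                                                    ∎
  where open ≡-Reasoning
rowOf-stack j (R ∷ Rs) (suc i) = begin
  rowOf k (atRow (suc j) (labels R) ++ stack (suc j) Rs)           ≡⟨ rowOf-++ k (atRow (suc j) (labels R)) _ ⟩
  rowOf k (atRow (suc j) (labels R)) ++ rowOf k (stack (suc j) Rs) ≡⟨ cong (_++ rowOf k (stack (suc j) Rs)) (rowOf-atRow-≢ (labels R) (<⇒≢ (s≤s (s≤s (m≤n+m j i))))) ⟩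
  rowOf k (stack (suc j) Rs)                                        ≡⟨ cong (λ n → rowOf (suc n) (stack (suc j) Rs)) (+-suc i j) ⟨
  rowOf (suc (i + suc j)) (stack (suc j) Rs)                        ≡⟨ rowOf-stack (suc j) Rs i ⟩
  rowLabels Rs i                                                    ∎
  where
  open ≡-Reasoning
  k = suc (suc i + j)

row-flatten : ∀ {Rs} → Linked Stacked Rs → ∀ i → row (suc i) (flatten Rs) ≡ rowLabels Rs i
row-flatten {Rs} ch i = begin
  rowOf (suc i) (heapRows (flatten Rs))  ≡⟨ cong (rowOf (suc i)) (heapRows-flatten ch) ⟩
  rowOf (suc i) (stack 0 Rs)             ≡⟨ cong (λ n → rowOf (suc n) (stack 0 Rs)) (+-identityʳ i) ⟨
  rowOf (suc (i + 0)) (stack 0 Rs)       ≡⟨ rowOf-stack 0 Rs i ⟩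
  rowLabels Rs i                         ∎
  where open ≡-Reasoning

-- Rows next to a row s₂

data Lone : Row → Gen → Gen → Set where
  lone₁ : Lone r₁ s₁ s₃
  lone₃ : Lone r₃ s₃ s₁

-- above lists the rows above A, nearest first.
data LoneOverR₂ (Rs : List Row) : Set where
  lone-over-r₂ : ∀ above {A s s′} below → Lone A s s′ → Rs ≡ above ʳ++ (A ∷ r₂ ∷ below) → LoneOverR₂ Rs

∷-LoneOverR₂ : ∀ {R Rs} → LoneOverR₂ Rs → LoneOverR₂ (R ∷ Rs)
∷-LoneOverR₂ {R} (lone-over-r₂ above below lone eq) =
  lone-over-r₂ (above ++ [ R ]) below lone (trans (cong (R ∷_) eq) (sym (++-ʳ++ above)))

odd-≁-s₂ : ∀ {R} → OddRow R → ¬ (labels R ↭ s₂ ∷ [])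
odd-≁-s₂ odd₁  p = case ∈-resp-↭ p (here refl) of λ { (here ()) ; (there ()) }
odd-≁-s₂ odd₃  p = case ∈-resp-↭ p (here refl) of λ { (here ()) ; (there ()) }
odd-≁-s₂ odd₁₃ p = case ↭-length p of λ ()
odd-≁-s₂ odd₃₁ p = case ↭-length p of λ ()

above-s₁s₃ : ∀ {Rs} → Linked Stacked Rs → ∀ k → rowLabels Rs (suc k) ↭ s₁ ∷ s₃ ∷ [] → rowLabels Rs k ↭ s₂ ∷ []
above-s₁s₃ []               k       p = case ↭-length p of λ ()
above-s₁s₃ [-]              k       p = case ↭-length p of λ ()
above-s₁s₃ (r₂-over _ ∷ _)  zero    p = ↭-refl
above-s₁s₃ (over-r₂ _ ∷ _)  zero    p = case ↭-length p of λ ()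
above-s₁s₃ (_ ∷ ch)         (suc k) p = above-s₁s₃ ch k p

above-s₂ : ∀ {Rs} → Linked Stacked Rs → ∀ k → rowLabels Rs (suc k) ↭ s₂ ∷ [] →
           rowLabels Rs k ↭ s₁ ∷ s₃ ∷ [] ⊎ LoneOverR₂ Rs
above-s₂ []                  k       p = case ↭-length p of λ ()
above-s₂ [-]                 k       p = case ↭-length p of λ ()
above-s₂ (r₂-over o ∷ _)     zero    p = ⊥-elim (odd-≁-s₂ o p)
above-s₂ (over-r₂ odd₁₃ ∷ _) zero    p = inj₁ ↭-refl
above-s₂ (over-r₂ odd₃₁ ∷ _) zero    p = inj₁ (↭-swap s₃ s₁ ↭-refl)
above-s₂ (over-r₂ odd₁ ∷ _)  zero    p = inj₂ (lone-over-r₂ [] _ lone₁ refl)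
above-s₂ (over-r₂ odd₃ ∷ _)  zero    p = inj₂ (lone-over-r₂ [] _ lone₃ refl)
above-s₂ (_ ∷ ch)            (suc k) p = map₂ ∷-LoneOverR₂ (above-s₂ ch k p)

-- Propagation of lone rows

lone-below-lone : ∀ {x} P {A s s′ R} q → Lone A s s′ → OddRow R →
                  x ≡ P ++ s₂ ∷ labels A ++ s₂ ∷ labels R ++ q → Reduced x → FC x → Lone R s′ s
lone-below-lone P q lone₁ odd₁  refl red fc = ⊥-elim (fc-braid-free P q a21 red fc ε)
lone-below-lone P q lone₁ odd₃  refl red fc = lone₃
lone-below-lone P q lone₁ odd₁₃ refl red fc = ⊥-elim (fc-braid-free P (s₃ ∷ q) a21 red fc ε)
lone-below-lone P q lone₁ odd₃₁ refl red fc =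
  ⊥-elim (fc-braid-free P (s₃ ∷ q) a21 red fc (++-≈C P (return (comm (s₂ ∷ s₁ ∷ s₂ ∷ []) q s₃ s₁ refl))))
lone-below-lone P q lone₃ odd₁  refl red fc = lone₁
lone-below-lone P q lone₃ odd₃  refl red fc = ⊥-elim (fc-braid-free P q a23 red fc ε)
lone-below-lone P q lone₃ odd₃₁ refl red fc = ⊥-elim (fc-braid-free P (s₁ ∷ q) a23 red fc ε)
lone-below-lone P q lone₃ odd₁₃ refl red fc =
  ⊥-elim (fc-braid-free P (s₁ ∷ q) a23 red fc (++-≈C P (return (comm (s₂ ∷ s₃ ∷ s₂ ∷ []) q s₁ s₃ refl))))

≈C-∷ʳ : ∀ {x} P c {w} → x ≈C (P ++ c ∷ w) → x ≈C (P ∷ʳ c ++ w)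
≈C-∷ʳ {x} P c {w} = subst (x ≈C_) (sym (∷ʳ-++ P c w))

lone-above-lone : ∀ {x} P {A s s′ R} q → Lone A s s′ → OddRow R →
                  x ≡ P ++ labels R ++ s₂ ∷ labels A ++ s₂ ∷ q → Reduced x → FC x → Lone R s′ s
lone-above-lone P q lone₁ odd₁  refl red fc = ⊥-elim (fc-braid-free P q a12 red fc ε)
lone-above-lone P q lone₁ odd₃  refl red fc = lone₃
lone-above-lone P q lone₁ odd₁₃ refl red fc = ⊥-elim (fc-braid-free (P ∷ʳ s₃) q a12 red fc
  (≈C-∷ʳ P s₃ (++-≈C P (return (comm [] (s₂ ∷ s₁ ∷ s₂ ∷ q) s₁ s₃ refl)))))
lone-above-lone P q lone₁ odd₃₁ refl red fc = ⊥-elim (fc-braid-free (P ∷ʳ s₃) q a12 red fc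
  (≈C-∷ʳ P s₃ ε))
lone-above-lone P q lone₃ odd₁  refl red fc = lone₁
lone-above-lone P q lone₃ odd₃  refl red fc = ⊥-elim (fc-braid-free P q a32 red fc ε)
lone-above-lone P q lone₃ odd₃₁ refl red fc = ⊥-elim (fc-braid-free (P ∷ʳ s₁) q a32 red fc
  (≈C-∷ʳ P s₁ (++-≈C P (return (comm [] (s₂ ∷ s₃ ∷ s₂ ∷ q) s₃ s₁ refl)))))
lone-above-lone P q lone₃ odd₁₃ refl red fc = ⊥-elim (fc-braid-free (P ∷ʳ s₁) q a32 red fc
  (≈C-∷ʳ P s₁ ε))

top-lone-below-lone : ∀ {x A s s′ R} q → Lone A s s′ → OddRow R →
                      x ≡ labels A ++ s₂ ∷ labels R ++ q → Reduced x → FC x → NonCancellable x → Lone R s′ s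
top-lone-below-lone q lone₁ odd₁  refl red fc nc = ⊥-elim (proj₁ nc s₁ s₂ (leftWSR a12 red fc ε))
top-lone-below-lone q lone₁ odd₃  refl red fc nc = lone₃
top-lone-below-lone q lone₁ odd₁₃ refl red fc nc = ⊥-elim (proj₁ nc s₁ s₂ (leftWSR a12 red fc ε))
top-lone-below-lone q lone₁ odd₃₁ refl red fc nc =
  ⊥-elim (proj₁ nc s₁ s₂ (leftWSR a12 red fc (return (comm [] q s₃ s₁ refl))))
top-lone-below-lone q lone₃ odd₁  refl red fc nc = lone₁
top-lone-below-lone q lone₃ odd₃  refl red fc nc = ⊥-elim (proj₁ nc s₃ s₂ (leftWSR a32 red fc ε))
top-lone-below-lone q lone₃ odd₃₁ refl red fc nc = ⊥-elim (proj₁ nc s₃ s₂ (leftWSR a32 red fc ε))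
top-lone-below-lone q lone₃ odd₁₃ refl red fc nc =
  ⊥-elim (proj₁ nc s₃ s₂ (leftWSR a32 red fc (return (comm [] q s₁ s₃ refl))))

data Single : Row → Set where
  single₂ : Single r₂
  single₁ : Single r₁
  single₃ : Single r₃

Lone⇒Single : ∀ {A s s′} → Lone A s s′ → Single A
Lone⇒Single lone₁ = single₁
Lone⇒Single lone₃ = single₃

Linked-drop : ∀ {a ℓ} {A : Set a} {R : Rel A ℓ} xs {ys} → Linked R (xs ++ ys) → Linked R ys
Linked-drop []       l = l
Linked-drop (x ∷ xs) l = Linked-drop xs (Linked.tail l)

OddRow-under-r₂ : ∀ {R} → Stacked r₂ R → OddRow R
OddRow-under-r₂ (r₂-over o) = o

OddRow-over-r₂ : ∀ {R} → Stacked R r₂ → OddRow R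
OddRow-over-r₂ (over-r₂ o)  = o
OddRow-over-r₂ (r₂-over ())

module Propagation {Rs} (chain : Linked Stacked Rs) (red : Reduced (flatten Rs))
                   (fc : FC (flatten Rs)) (nc : NonCancellable (flatten Rs)) where

  stacked-at : ∀ above {R R′} below → Rs ≡ above ʳ++ (R ∷ R′ ∷ below) → Stacked R R′
  stacked-at above below eq =
    Linked.head (Linked-drop (reverse above) (subst (Linked Stacked) (trans eq (ʳ++-defn above)) chain))

  flatten-at : ∀ above ys → Rs ≡ above ʳ++ ys → flatten Rs ≡ flatten (reverse above) ++ flatten ys
  flatten-at above ys eq = trans (cong flatten (trans eq (ʳ++-defn above))) (flatten-++ (reverse above) ys)

  lone-below : ∀ above {A s s′ R} below → Lone A s s′ → Rs ≡ above ʳ++ (A ∷ r₂ ∷ R ∷ below) → Lone R s′ s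
  lone-below [] {A} below lone eq =
    top-lone-below-lone (flatten below) lone (OddRow-under-r₂ (stacked-at [ A ] below eq)) (cong flatten eq) red fc nc
  lone-below (R₀ ∷ above) {A} below lone eq with stacked-at above _ eq
  ... | r₂-over _ = lone-below-lone (flatten (reverse above)) (flatten below) lone
                      (OddRow-under-r₂ (stacked-at (A ∷ r₂ ∷ above) below eq)) (flatten-at above _ eq) red fc
  ... | over-r₂ _ = case lone of λ ()

  lone-above : ∀ above {A s s′ R} below → Lone A s s′ → Rs ≡ above ʳ++ (R ∷ r₂ ∷ A ∷ r₂ ∷ below) → Lone R s′ s
  lone-above above below lone eq = lone-above-lone (flatten (reverse above)) (flatten below) lone
    (OddRow-over-r₂ (stacked-at above _ eq)) (flatten-at above _ eq) red fc

  down : ∀ above {A s s′} below → Lone A s s′ → Rs ≡ above ʳ++ (A ∷ below) → All Single (A ∷ below)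
  down above [] lone eq = Lone⇒Single lone ∷ []
  down above (R ∷ below) lone eq with stacked-at above below eq
  ... | r₂-over _ = case lone of λ ()
  down above (.r₂ ∷ [])            lone eq | over-r₂ _ = Lone⇒Single lone ∷ single₂ ∷ []
  down above {A} (.r₂ ∷ R ∷ below) lone eq | over-r₂ _ =
    Lone⇒Single lone ∷ single₂ ∷ down (r₂ ∷ A ∷ above) below (lone-below above below lone eq) eq

  up : ∀ above {A s s′} below → Lone A s s′ → Rs ≡ above ʳ++ (A ∷ r₂ ∷ below) →
       All Single (A ∷ r₂ ∷ below) → All Single Rs
  up [] below lone eq singles = subst (All Single) (sym eq) singles
  up (R ∷ above) below lone eq singles with stacked-at above (r₂ ∷ below) eq
  ... | over-r₂ _ = case lone of λ ()
  up (.r₂ ∷ [])          below lone eq singles | r₂-over _ = subst (All Single) (sym eq) (single₂ ∷ singles)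
  up (.r₂ ∷ R ∷ above) {A} {s} {s′} below lone eq singles | r₂-over _ =
    up above (A ∷ r₂ ∷ below) lone′ eq (Lone⇒Single lone′ ∷ single₂ ∷ singles)
    where
    lone′ : Lone R s′ s
    lone′ = lone-above above below lone eq

  all-single : LoneOverR₂ Rs → All Single Rs
  all-single (lone-over-r₂ above below lone eq) = up above below lone eq (down above (r₂ ∷ below) lone eq)

zigzag : ∀ {Rs} → Linked Stacked Rs → All Single Rs → Linked Adj (flatten Rs)
zigzag []       []                  = []
zigzag [-]      (single₂ ∷ [])      = [-]
zigzag [-]      (single₁ ∷ [])      = [-]
zigzag [-]      (single₃ ∷ [])      = [-]
zigzag (_ ∷ ch) (single₂ ∷ ss@(single₁ ∷ _)) = a21 ∷ zigzag ch ss
zigzag (_ ∷ ch) (single₂ ∷ ss@(single₃ ∷ _)) = a23 ∷ zigzag ch ss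
zigzag (_ ∷ ch) (single₁ ∷ ss@(single₂ ∷ _)) = a12 ∷ zigzag ch ss
zigzag (_ ∷ ch) (single₃ ∷ ss@(single₂ ∷ _)) = a32 ∷ zigzag ch ss
zigzag (r₂-over () ∷ _) (single₂ ∷ single₂ ∷ _)
zigzag (() ∷ _) (single₁ ∷ single₁ ∷ _)
zigzag (() ∷ _) (single₁ ∷ single₃ ∷ _)
zigzag (() ∷ _) (single₃ ∷ single₁ ∷ _)
zigzag (() ∷ _) (single₃ ∷ single₃ ∷ _)

stacked-typeI : ∀ {Rs} → Linked Stacked Rs → Reduced (flatten Rs) → FC (flatten Rs) →
                NonCancellable (flatten Rs) → LoneOverR₂ Rs → TypeI (flatten Rs)
stacked-typeI chain red fc nc lone =
  _ , ε , red , zigzag chain (Propagation.all-single chain red fc nc lone)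

lemma5p6 : (x : List Gen) → Reduced x → FC x → NonCancellable x → ¬ TypeI x →
    (k : ℕ) → 1 ≤ k →
    (row (suc k) x ↭ s₁ ∷ s₃ ∷ [] → row k x ↭ s₂ ∷ []) ×
    (row (suc k) x ↭ s₂ ∷ [] → row k x ↭ s₁ ∷ s₃ ∷ [])
lemma5p6 x red fc nc ¬typeI zero ()
lemma5p6 x red fc nc ¬typeI (suc k) _ with toRows x | toRows-stacked x red | flatten-toRows x
... | Rs | chain | refl rewrite row-flatten chain k | row-flatten chain (suc k) =
  above-s₁s₃ chain k ,
  λ r → [ id , (λ lone → ⊥-elim (¬typeI (stacked-typeI chain red fc nc lone))) ]′ (above-s₂ chain k r)
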